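{- For any graph $H$ of order at least $2$, $\operatorname{adim}_2(K_1+H)\le\operatorname{adim}_2(H)+2$.
   Context: All graphs are finite and simple. The join $K_1+H$ is obtained from $H$ by adding a new vertex adjacent to all vertices of $H$. For a graph $G=(V,E)$, $d_{G,2}(x,y)=\min\{d_G(x,y),2\}$ with $d_G$ the shortest-path distance ($\infty$ between different components). For distinct $x,y$, $\mathcal{C}_G(x,y)=\{z\in V: d_{G,2}(x,z)\ne d_{G,2}(y,z)\}$. A set $S\subseteq V$ is a $2$-adjacency generator if $|S\cap\mathcal{C}_G(x,y)|\ge 2$ for all distinct $x,y$; $\operatorname{adim}_2(G)$ is the minimum cardinality of such a set. -}

module Defs where

open import Data.Bool using (Bool; true; false; not; if_then_else_)
open import Data.Nat using (ℕ; zero; suc; _≤_; _≡ᵇ_)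
open import Data.Fin using (Fin; zero; suc; _≟_)
open import Data.Fin.Subset using (Subset; _∩_; ∣_∣; _∈_)
open import Data.Vec using (tabulate)
open import Data.Product using (Σ; _×_; _,_)
open import Relation.Nullary using (¬_; yes; no)
open import Relation.Binary.PropositionalEquality using (_≡_)

record Graph (n : ℕ) : Set where
  field
    adj    : Fin n → Fin n → Bool
    sym    : ∀ x y → adj x y ≡ adj y x
    irrefl : ∀ x → adj x x ≡ false
open Graph public

-- d_{G,2}(x,y) = min(d_G(x,y), 2): 0 if x = y, 1 if adjacent, 2 otherwise
-- (distance ≥ 2, including ∞ between different components).
d2 : ∀ {n} → Graph n → Fin n → Fin n → ℕ
d2 G x y with x ≟ y
... | yes _ = 0
... | no _  = if adj G x y then 1 else 2

C : ∀ {n} → Graph n → Fin n → Fin n → Subset n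
C G x y = tabulate (λ z → not (d2 G x z ≡ᵇ d2 G y z))

Is2AdjGen : ∀ {n} → Graph n → Subset n → Set
Is2AdjGen {n} G S = ∀ (x y : Fin n) → ¬ (x ≡ y) → 2 ≤ ∣ S ∩ C G x y ∣

IsAdim2 : ∀ {n} → Graph n → ℕ → Set
IsAdim2 {n} G k =
  (Σ (Subset n) (λ S → Is2AdjGen G S × ∣ S ∣ ≡ k))
  × (∀ (S : Subset n) → Is2AdjGen G S → k ≤ ∣ S ∣)

join : ∀ {n} → Graph n → Graph (suc n)
join {n} H = record { adj = a ; sym = s ; irrefl = i }
  where
    a : Fin (suc n) → Fin (suc n) → Bool
    a zero zero = false
    a zero (suc _) = true
    a (suc _) zero = true
    a (suc x) (suc y) = adj H x y
    s : ∀ x y → a x y ≡ a y x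
    s zero zero = _≡_.refl
    s zero (suc _) = _≡_.refl
    s (suc _) zero = _≡_.refl
    s (suc x) (suc y) = sym H x y
    i : ∀ x → a x x ≡ false
    i zero = _≡_.refl
    i (suc x) = irrefl H x

-- Let S be a 2-adjacency generator of H. In K₁ + H the apex is at distance 1 from every
-- vertex of H, and vertices of H keep their truncated distances, so S still separates every
-- pair of vertices of H. The apex and a vertex y are separated by the apex itself and by any
-- vertex of S not adjacent to y (y itself if y ∈ S). So only a vertex adjacent to all of S
-- needs care, and there is at most one such vertex: two of them would be at distance 1 from
-- every vertex of S and hence not separated by S. Adding the apex and this vertex to S
-- gives a generator of K₁ + H.
module Submission where

open import Defs hiding (sym)
open import Data.Bool using (Bool; true; false; not)
open import Data.Bool.Properties using (¬-not)
open import Data.Empty using (⊥-elim)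
open import Data.Fin using (Fin; zero; suc; _≟_)
open import Data.Fin.Properties using (any?; suc-injective)
open import Data.Fin.Subset using (Subset; _∩_; _∪_; ∣_∣; _∈_; _⊆_; ⁅_⁆; inside; outside)
  renaming (⊥ to ∅)
open import Data.Fin.Subset.Properties
  using (_∈?_; x∈p∩q⁺; x∈p∩q⁻; x∈p∪q⁺; p⊆p∪q; x∈⁅x⁆; ∣⁅x⁆∣≡1; ∣⊥∣≡0; p⊆q⇒∣p∣≤∣q∣;
         x∈p⇒∣p-x∣<∣p∣; x∈p∧x≢y⇒x∈p-y)
open import Data.Nat using (ℕ; zero; suc; _+_; _≤_; z≤n; s≤s; _≡ᵇ_)
open import Data.Nat.Properties
  using (≤-trans; ≤-<-trans; ≤-reflexive; n≤1+n; +-suc; +-comm; +-monoʳ-≤; module ≤-Reasoning)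
open import Data.Product using (∃-syntax; _×_; _,_)
open import Data.Sum using (inj₂)
open import Data.Vec using ([]; _∷_; tabulate; here; there)
open import Data.Vec.Properties using (lookup∘tabulate; lookup⇒[]=; []=⇒lookup; tabulate-cong)
open import Function using (_∘_; id)
open import Relation.Nullary using (¬_; Dec; yes; no; contradiction)
open import Relation.Nullary.Decidable using (¬?; _×-dec_; decidable-stable)
open import Relation.Binary.PropositionalEquality
  using (_≡_; _≢_; refl; sym; trans; cong; cong₂; subst)

≡ᵇ-comm : ∀ m n → (m ≡ᵇ n) ≡ (n ≡ᵇ m)
≡ᵇ-comm zero    zero    = refl
≡ᵇ-comm zero    (suc n) = refl
≡ᵇ-comm (suc m) zero    = refl
≡ᵇ-comm (suc m) (suc n) = ≡ᵇ-comm m n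

m≢n⇒not[m≡ᵇn] : ∀ {m n} → m ≢ n → not (m ≡ᵇ n) ≡ true
m≢n⇒not[m≡ᵇn] {zero}  {zero}  m≢n = contradiction refl m≢n
m≢n⇒not[m≡ᵇn] {zero}  {suc n} _   = refl
m≢n⇒not[m≡ᵇn] {suc m} {zero}  _   = refl
m≢n⇒not[m≡ᵇn] {suc m} {suc n} m≢n = m≢n⇒not[m≡ᵇn] (m≢n ∘ cong suc)

not[m≡ᵇn]⇒m≢n : ∀ {m n} → not (m ≡ᵇ n) ≡ true → m ≢ n
not[m≡ᵇn]⇒m≢n {suc m} h refl = not[m≡ᵇn]⇒m≢n {m} h refl

∣p∪q∣≤∣p∣+∣q∣ : ∀ {n} (p q : Subset n) → ∣ p ∪ q ∣ ≤ ∣ p ∣ + ∣ q ∣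
∣p∪q∣≤∣p∣+∣q∣ []            []            = z≤n
∣p∪q∣≤∣p∣+∣q∣ (inside  ∷ p) (inside  ∷ q) =
  s≤s (≤-trans (∣p∪q∣≤∣p∣+∣q∣ p q) (+-monoʳ-≤ ∣ p ∣ (n≤1+n ∣ q ∣)))
∣p∪q∣≤∣p∣+∣q∣ (inside  ∷ p) (outside ∷ q) = s≤s (∣p∪q∣≤∣p∣+∣q∣ p q)
∣p∪q∣≤∣p∣+∣q∣ (outside ∷ p) (inside  ∷ q) =
  subst (suc ∣ p ∪ q ∣ ≤_) (sym (+-suc ∣ p ∣ ∣ q ∣)) (s≤s (∣p∪q∣≤∣p∣+∣q∣ p q))
∣p∪q∣≤∣p∣+∣q∣ (outside ∷ p) (outside ∷ q) = ∣p∪q∣≤∣p∣+∣q∣ p q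

∣p∪⁅x⁆∣≤1+∣p∣ : ∀ {n} (p : Subset n) x → ∣ p ∪ ⁅ x ⁆ ∣ ≤ suc ∣ p ∣
∣p∪⁅x⁆∣≤1+∣p∣ p x = ≤-trans (∣p∪q∣≤∣p∣+∣q∣ p ⁅ x ⁆)
  (≤-reflexive (trans (cong (∣ p ∣ +_) (∣⁅x⁆∣≡1 x)) (+-comm ∣ p ∣ 1)))

x∈p∧y∈p∧x≢y⇒2≤∣p∣ : ∀ {n} {p : Subset n} {x y} → x ∈ p → y ∈ p → x ≢ y → 2 ≤ ∣ p ∣
x∈p∧y∈p∧x≢y⇒2≤∣p∣ x∈p y∈p x≢y =
  ≤-trans (s≤s (≤-<-trans z≤n (x∈p⇒∣p-x∣<∣p∣ (x∈p∧x≢y⇒x∈p-y y∈p (x≢y ∘ sym)))))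
          (x∈p⇒∣p-x∣<∣p∣ x∈p)

x∈tabulate⁺ : ∀ {n} {f : Fin n → Bool} {x} → f x ≡ true → x ∈ tabulate f
x∈tabulate⁺ {f = f} {x} fx = lookup⇒[]= x (tabulate f) (trans (lookup∘tabulate f x) fx)

x∈tabulate⁻ : ∀ {n} {f : Fin n → Bool} {x} → x ∈ tabulate f → f x ≡ true
x∈tabulate⁻ {f = f} {x} x∈f = trans (sym (lookup∘tabulate f x)) ([]=⇒lookup x∈f)

module _ {n} (G : Graph n) where

  d2-adj : ∀ {x y} → adj G x y ≡ true → d2 G x y ≡ 1
  d2-adj {x} {y} x~y with x ≟ y
  ... | yes refl = contradiction (trans (sym x~y) (irrefl G x)) λ ()
  ... | no  _    rewrite x~y = refl

  d2-nonadj : ∀ {x y} → adj G x y ≡ false → d2 G x y ≢ 1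
  d2-nonadj {x} {y} x≁y with x ≟ y
  ... | yes _ = λ ()
  ... | no  _ rewrite x≁y = λ ()

  ∈C⁺ : ∀ x y {z} → d2 G x z ≢ d2 G y z → z ∈ C G x y
  ∈C⁺ x y = x∈tabulate⁺ ∘ m≢n⇒not[m≡ᵇn]

  ∈C⁻ : ∀ x y {z} → z ∈ C G x y → d2 G x z ≢ d2 G y z
  ∈C⁻ x y = not[m≡ᵇn]⇒m≢n ∘ x∈tabulate⁻

  C-comm : ∀ x y → C G x y ≡ C G y x
  C-comm x y = tabulate-cong λ z → cong not (≡ᵇ-comm (d2 G x z) (d2 G y z))

  Is2AdjGen-mono : ∀ {S T} → S ⊆ T → Is2AdjGen G S → Is2AdjGen G T
  Is2AdjGen-mono {S} {T} S⊆T gen x y x≢y =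
    ≤-trans (gen x y x≢y) (p⊆q⇒∣p∣≤∣q∣ (λ z∈ → let z∈S , z∈C = x∈p∩q⁻ S (C G x y) z∈
                                                in x∈p∩q⁺ (S⊆T z∈S , z∈C)))

  NonNeighbourIn : Subset n → Fin n → Set
  NonNeighbourIn S y = ∃[ z ] z ∈ S × adj G y z ≡ false

  nonNeighbourIn? : ∀ S y → Dec (NonNeighbourIn S y)
  nonNeighbourIn? S y = any? λ z → (z ∈? S) ×-dec (adj G y z Data.Bool.≟ false)

  NonNeighbourIn-mono : ∀ {S T y} → S ⊆ T → NonNeighbourIn S y → NonNeighbourIn T y
  NonNeighbourIn-mono S⊆T (z , z∈S , y≁z) = z , S⊆T z∈S , y≁z

  NonNeighbourIn-self : ∀ {S y} → y ∈ S → NonNeighbourIn S y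
  NonNeighbourIn-self {y = y} y∈S = y , y∈S , irrefl G y

  ¬NonNeighbourIn⇒d2≡1 : ∀ {S y z} → ¬ NonNeighbourIn S y → z ∈ S → d2 G y z ≡ 1
  ¬NonNeighbourIn⇒d2≡1 ¬nn z∈S = d2-adj (¬-not λ y≁z → ¬nn (_ , z∈S , y≁z))

  ¬NonNeighbourIn-unique : ∀ {S y y′} → Is2AdjGen G S →
    ¬ NonNeighbourIn S y → ¬ NonNeighbourIn S y′ → y ≡ y′
  ¬NonNeighbourIn-unique {S} {y} {y′} gen ¬nn ¬nn′ with y ≟ y′
  ... | yes y≡y′ = y≡y′
  ... | no  y≢y′ = contradiction
    (≤-trans (gen y y′ y≢y′) (subst (∣ S ∩ C G y y′ ∣ ≤_) (∣⊥∣≡0 n) (p⊆q⇒∣p∣≤∣q∣ S∩C⊆∅)))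
    λ ()
    where
    S∩C⊆∅ : S ∩ C G y y′ ⊆ ∅
    S∩C⊆∅ z∈ with x∈p∩q⁻ S (C G y y′) z∈
    ... | z∈S , z∈C =
      ⊥-elim (∈C⁻ y y′ z∈C (trans (¬NonNeighbourIn⇒d2≡1 ¬nn z∈S)
                             (sym (¬NonNeighbourIn⇒d2≡1 ¬nn′ z∈S))))

  extend-to-nonNeighbourCover : ∀ S → Is2AdjGen G S →
    ∃[ T ] S ⊆ T × ∣ T ∣ ≤ suc ∣ S ∣ × (∀ y → NonNeighbourIn T y)
  extend-to-nonNeighbourCover S gen with any? (¬? ∘ nonNeighbourIn? S)
  ... | no  noneBad = S , id , n≤1+n ∣ S ∣ ,
    λ y → decidable-stable (nonNeighbourIn? S y) (λ ¬nn → noneBad (y , ¬nn))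
  ... | yes (y₀ , bad₀) = S ∪ ⁅ y₀ ⁆ , p⊆p∪q ⁅ y₀ ⁆ , ∣p∪⁅x⁆∣≤1+∣p∣ S y₀ , cover
    where
    cover : ∀ y → NonNeighbourIn (S ∪ ⁅ y₀ ⁆) y
    cover y with nonNeighbourIn? S y
    ... | yes nn  = NonNeighbourIn-mono (p⊆p∪q ⁅ y₀ ⁆) nn
    ... | no  bad rewrite ¬NonNeighbourIn-unique gen bad bad₀ =
      NonNeighbourIn-self (x∈p∪q⁺ (inj₂ (x∈⁅x⁆ y₀)))

module _ {n} (H : Graph n) where

  d2-join-suc : ∀ x z → d2 (join H) (suc x) (suc z) ≡ d2 H x z
  d2-join-suc x z with x ≟ z
  ... | yes refl = refl
  ... | no  x≢z with suc x ≟ suc z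
  ...   | yes sx≡sz = contradiction (suc-injective sx≡sz) x≢z
  ...   | no  _     = refl

  C-join-suc : ∀ x y → C (join H) (suc x) (suc y) ≡ outside ∷ C H x y
  C-join-suc x y = cong (outside ∷_) (tabulate-cong λ z →
    cong not (cong₂ _≡ᵇ_ (d2-join-suc x z) (d2-join-suc y z)))

  join-apex-pair : ∀ {T} → (∀ y → NonNeighbourIn H T y) →
    ∀ y → 2 ≤ ∣ (inside ∷ T) ∩ C (join H) zero (suc y) ∣
  join-apex-pair cover y with cover y
  ... | z , z∈T , y≁z = x∈p∧y∈p∧x≢y⇒2≤∣p∣
    (x∈p∩q⁺ (here , ∈C⁺ (join H) zero (suc y) λ ()))
    (x∈p∩q⁺ (there z∈T , ∈C⁺ (join H) zero (suc y) λ 1≡d →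
      d2-nonadj H y≁z (sym (trans 1≡d (d2-join-suc y z)))))
    λ ()

  join-generator : ∀ {T} → Is2AdjGen H T → (∀ y → NonNeighbourIn H T y) →
    Is2AdjGen (join H) (inside ∷ T)
  join-generator gen cover zero    zero    0≢0 = contradiction refl 0≢0
  join-generator gen cover zero    (suc y) _   = join-apex-pair cover y
  join-generator {T} gen cover (suc y) zero _  =
    subst (λ c → 2 ≤ ∣ (inside ∷ T) ∩ c ∣) (C-comm (join H) zero (suc y)) (join-apex-pair cover y)
  join-generator {T} gen cover (suc x) (suc y) sx≢sy =
    subst (λ c → 2 ≤ ∣ (inside ∷ T) ∩ c ∣) (sym (C-join-suc x y)) (gen x y (sx≢sy ∘ cong suc))

theorem38 : ∀ (n : ℕ) → 2 ≤ n → (H : Graph n) → (a b : ℕ)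
    → IsAdim2 (join H) a → IsAdim2 H b → a ≤ b + 2
theorem38 n _ H a b (_ , minimal) ((S , gen , ∣S∣≡b) , _)
  with extend-to-nonNeighbourCover H S gen
... | T , S⊆T , ∣T∣≤1+∣S∣ , cover = begin
  a          ≤⟨ minimal (inside ∷ T) (join-generator H (Is2AdjGen-mono H {S} S⊆T gen) cover) ⟩
  suc ∣ T ∣  ≤⟨ s≤s ∣T∣≤1+∣S∣ ⟩
  2 + ∣ S ∣  ≡⟨ cong (2 +_) ∣S∣≡b ⟩
  2 + b      ≡⟨ +-comm 2 b ⟩
  b + 2      ∎
  where open ≤-Reasoning
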